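{- Let $\varphi_1,\ldots,\varphi_n$ be unital positive definite linear functionals on $\mathbb{R}\langle x_1,\ldots,x_n\rangle$. Define the linear functional $\psi$ on $\mathbb{R}\langle x_1,\ldots,x_n\rangle$ by $\psi[1]=\psi[x_i]=0$, $\psi[x_ix_j]=\delta_{ij}$, and $\psi[x_iP(\mathbf{x})x_j]=\delta_{ij}\varphi_i[P(\mathbf{x})]$ for all polynomials $P$ and all $i,j$. Then $\psi$ is conditionally positive definite.
   Context: $x_i$ are non-commuting indeterminates; $*$ is the linear involution on $\mathbb{R}\langle\mathbf{x}\rangle$ with $(x_{u(1)}\cdots x_{u(k)})^*=x_{u(k)}\cdots x_{u(1)}$. Positive definite means $\varphi_i[A^*A]\ge0$ for all $A$. A functional $\psi$ is conditionally positive definite if it is positive definite on polynomials of degree at least 2, i.e. $\psi[A^*A]\ge0$ for every polynomial $A$ with zero constant term. -}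

module Defs where

open import Level using (Level; _⊔_; suc)
open import Algebra.Bundles using (CommutativeRing)
open import Data.Nat using (ℕ)
open import Data.Fin using (Fin; _≟_)
open import Data.List using (List; []; _∷_; _++_; map; concatMap; reverse; foldr; [_])
open import Data.Product using (_×_; _,_; Σ; ∃)
open import Relation.Binary.Definitions using (Total)
open import Relation.Nullary using (¬_; yes; no)

-- The real numbers, axiomatically: a complete (Dedekind) ordered field.
-- (agda-stdlib has no real numbers; ℝ is the unique model of these axioms.)

record RealField (c ℓ : Level) : Set (suc (c ⊔ ℓ)) where
  field
    commRing : CommutativeRing c ℓ
  open CommutativeRing commRing public
  field
    _≤_       : Carrier → Carrier → Set ℓ
    ≤-refl    : ∀ {x y} → x ≈ y → x ≤ y
    ≤-trans   : ∀ {x y z} → x ≤ y → y ≤ z → x ≤ z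
    ≤-antisym : ∀ {x y} → x ≤ y → y ≤ x → x ≈ y
    ≤-total   : Total _≤_
    +-mono-≤  : ∀ {x y} z → x ≤ y → (x + z) ≤ (y + z)
    *-nonneg  : ∀ {x y} → 0# ≤ x → 0# ≤ y → 0# ≤ (x * y)
    0≉1       : ¬ (0# ≈ 1#)
    inverse   : ∀ x → ¬ (x ≈ 0#) → Σ Carrier λ y → (x * y) ≈ 1#
    sup       : (S : Carrier → Set ℓ) → (∃ λ x → S x) →
                (∃ λ b → ∀ x → S x → x ≤ b) →
                Σ Carrier λ s → (∀ x → S x → x ≤ s) ×
                                (∀ b → (∀ x → S x → x ≤ b) → s ≤ b)

-- Noncommutative polynomials ℝ⟨x₁,…,xₙ⟩ over a RealField R.
-- A word (monomial) in x₁,…,xₙ is a list of indices; a polynomial is a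
-- finite formal sum of (coefficient , word) terms.

module NCPoly {c ℓ} (R : RealField c ℓ) (n : ℕ) where
  open RealField R

  Word : Set
  Word = List (Fin n)

  Poly : Set c
  Poly = List (Carrier × Word)

  one : Poly
  one = [ (1# , []) ]

  var : Fin n → Poly
  var i = [ (1# , [ i ]) ]

  _·_ : Poly → Poly → Poly
  p · q = concatMap (λ { (a , u) → map (λ { (b , v) → (a * b , u ++ v) }) q }) p

  star : Poly → Poly
  star = map (λ { (a , w) → (a , reverse w) })

  constTerm : Poly → Carrier
  constTerm = foldr (λ { (a , []) s → a + s ; (a , _ ∷ _) s → s }) 0#

  -- A linear functional on ℝ⟨x⟩ is determined by its values on the word
  -- basis; ⟦ φ ⟧ P is its linear extension evaluated at P.
  Functional : Set c
  Functional = Word → Carrier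

  ⟦_⟧ : Functional → Poly → Carrier
  ⟦ φ ⟧ p = foldr (λ { (a , w) s → (a * φ w) + s }) 0# p

  Unital : Functional → Set ℓ
  Unital φ = ⟦ φ ⟧ one ≈ 1#

  PositiveDefinite : Functional → Set (c ⊔ ℓ)
  PositiveDefinite φ = ∀ (A : Poly) → 0# ≤ ⟦ φ ⟧ (star A · A)

  ConditionallyPositiveDefinite : Functional → Set (c ⊔ ℓ)
  ConditionallyPositiveDefinite ψ =
    ∀ (A : Poly) → constTerm A ≈ 0# → 0# ≤ ⟦ ψ ⟧ (star A · A)

  δ : Fin n → Fin n → Carrier
  δ i j with i ≟ j
  ... | yes _ = 1#
  ... | no _  = 0#

{-# OPTIONS --safe #-}
-- Split every nonconstant monomial of A by its last letter, A = Σᵢ Aᵢ xᵢ + (constant terms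
-- summing to 0). Then ψ[A* A] = Σᵢⱼ ψ[xᵢ Aᵢ* Aⱼ xⱼ] = Σᵢ φᵢ[Aᵢ* Aᵢ] ≥ 0, because the sandwich
-- rule kills the terms with i ≠ j: the Gram sum of ψ over the monomials of A is block
-- diagonal, with blocks indexed by the last letter.
module Submission where

open import Defs
open import Data.Nat using (ℕ; _<_)
open import Data.Fin using (Fin; _≟_)

import Algebra.Properties.CommutativeSemigroup as CommutativeSemigroupProperties
open import Algebra.Bundles using (CommutativeSemiring)
open import Data.List
  using (List; []; _∷_; _++_; _∷ʳ_; [_]; map; reverse; length; filter; initLast; _∷ʳ′_)
open import Data.List.Properties using (filter-notAll; reverse-++; ++-assoc)
open import Data.List.Relation.Unary.All as All using (All; []; _∷_)
open import Data.List.Relation.Unary.All.Properties using (all-filter)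
open import Data.List.Relation.Unary.Any using (here)
open import Data.Nat.Induction using (<-wellFounded)
open import Data.Product using (_×_; _,_; proj₁; proj₂)
open import Function using (_∘_)
open import Induction.WellFounded using (Acc; acc)
open import Relation.Binary.Definitions using (DecidableEquality)
open import Relation.Binary.PropositionalEquality as ≡ using (_≡_; _≢_)
open import Relation.Nullary using (¬_; yes; no; contradiction)
open import Relation.Nullary.Decidable using (¬?)
open import Relation.Unary using (Pred; Decidable)

reverse-∷ʳ-++-∷ʳ : ∀ {a} {A : Set a} (v : List A) i u j →
                   reverse (v ∷ʳ i) ++ (u ∷ʳ j) ≡ i ∷ ((reverse v ++ u) ∷ʳ j)
reverse-∷ʳ-++-∷ʳ v i u j =
  ≡.trans (≡.cong (_++ (u ∷ʳ j)) (reverse-++ v [ i ]))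
          (≡.cong (i ∷_) (≡.sym (++-assoc (reverse v) u [ j ])))

module FiniteSums {c ℓ} (R : CommutativeSemiring c ℓ) where
  open CommutativeSemiring R
  private module +CS = CommutativeSemigroupProperties +-commutativeSemigroup
  open import Relation.Binary.Reasoning.Setoid setoid

  ∑ : ∀ {a} {X : Set a} → List X → (X → Carrier) → Carrier
  ∑ []       g = 0#
  ∑ (x ∷ xs) g = g x + ∑ xs g

  syntax ∑ xs (λ x → e) = ∑[ x ∈ xs ] e

  module _ {a} {X : Set a} where

    ∑-cong : ∀ {g h : X → Carrier} {xs} →
             All (λ x → g x ≈ h x) xs → ∑ xs g ≈ ∑ xs h
    ∑-cong []       = refl
    ∑-cong (e ∷ es) = +-cong e (∑-cong es)

    ∑-zero : ∀ {g : X → Carrier} {xs} → All (λ x → g x ≈ 0#) xs → ∑ xs g ≈ 0#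
    ∑-zero []       = refl
    ∑-zero (e ∷ es) = trans (+-cong e (∑-zero es)) (+-identityˡ 0#)

    ∑-distrib-+ : ∀ (g h : X → Carrier) xs → ∑[ x ∈ xs ] (g x + h x) ≈ ∑ xs g + ∑ xs h
    ∑-distrib-+ g h []       = sym (+-identityˡ 0#)
    ∑-distrib-+ g h (x ∷ xs) =
      trans (+-congˡ (∑-distrib-+ g h xs)) (+CS.interchange (g x) (h x) (∑ xs g) (∑ xs h))

    *-distribˡ-∑ : ∀ k (g : X → Carrier) xs → k * ∑ xs g ≈ ∑[ x ∈ xs ] (k * g x)
    *-distribˡ-∑ k g []       = zeroʳ k
    *-distribˡ-∑ k g (x ∷ xs) =
      trans (distribˡ k (g x) (∑ xs g)) (+-congˡ (*-distribˡ-∑ k g xs))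

    ∑-partition : ∀ {p} {P : Pred X p} (P? : Decidable P) (g : X → Carrier) xs →
                  ∑ xs g ≈ ∑ (filter P? xs) g + ∑ (filter (¬? ∘ P?) xs) g
    ∑-partition P? g []       = sym (+-identityˡ 0#)
    ∑-partition P? g (x ∷ xs) with P? x
    ... | yes _ = trans (+-congˡ (∑-partition P? g xs)) (sym (+-assoc _ _ _))
    ... | no  _ = trans (+-congˡ (∑-partition P? g xs)) (+CS.x∙yz≈y∙xz _ _ _)

  ∑-map : ∀ {a b} {X : Set a} {Y : Set b} (f : X → Y) (g : Y → Carrier) xs →
          ∑ (map f xs) g ≈ ∑[ x ∈ xs ] g (f x)
  ∑-map f g []       = refl
  ∑-map f g (x ∷ xs) = +-congˡ (∑-map f g xs)

  gramSum : ∀ {a b} {X : Set a} {Y : Set b} → (X → Y → Carrier) → List X → List Y → Carrier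
  gramSum K A C = ∑[ t ∈ A ] ∑[ s ∈ C ] K t s

  module _ {a b} {X : Set a} {Y : Set b} where

    gramSum-cong : ∀ {K L : X → Y → Carrier} {A C} →
                   All (λ t → All (λ s → K t s ≈ L t s) C) A → gramSum K A C ≈ gramSum L A C
    gramSum-cong = ∑-cong ∘ All.map ∑-cong

    gramSum-zero : ∀ {K : X → Y → Carrier} {A C} →
                   All (λ t → All (λ s → K t s ≈ 0#) C) A → gramSum K A C ≈ 0#
    gramSum-zero = ∑-zero ∘ All.map ∑-zero

  gramSum-map : ∀ {a b} {X : Set a} {Y : Set b} (f : X → Y) (K : Y → Y → Carrier) T →
                gramSum K (map f T) (map f T) ≈ gramSum (λ t s → K (f t) (f s)) T T
  gramSum-map f K T =
    trans (∑-map f _ T) (∑-cong (All.universal (λ t → ∑-map f (K (f t)) T) T))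

  module _ {a p} {X : Set a} {P : Pred X p} (P? : Decidable P) {K : X → X → Carrier}
           (vanishesˡ : ∀ {t s} → P t → ¬ P s → K t s ≈ 0#)
           (vanishesʳ : ∀ {t s} → ¬ P t → P s → K t s ≈ 0#) where

    gramSum-partition : ∀ T → let Y = filter P? T; N = filter (¬? ∘ P?) T in
                        gramSum K T T ≈ gramSum K Y Y + gramSum K N N
    gramSum-partition T = begin
      gramSum K T T
        ≈⟨ ∑-partition P? _ T ⟩
      ∑[ t ∈ Y ] ∑ T (K t) + ∑[ t ∈ N ] ∑ T (K t)
        ≈⟨ +-cong (∑-cong (All.universal splitRow Y)) (∑-cong (All.universal splitRow N)) ⟩
      ∑[ t ∈ Y ] (∑ Y (K t) + ∑ N (K t)) + ∑[ t ∈ N ] (∑ Y (K t) + ∑ N (K t))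
        ≈⟨ +-cong (∑-distrib-+ _ _ Y) (∑-distrib-+ _ _ N) ⟩
      (gramSum K Y Y + gramSum K Y N) + (gramSum K N Y + gramSum K N N)
        ≈⟨ +-cong (+-congˡ YN≈0) (+-congʳ NY≈0) ⟩
      (gramSum K Y Y + 0#) + (0# + gramSum K N N)
        ≈⟨ +-cong (+-identityʳ _) (+-identityˡ _) ⟩
      gramSum K Y Y + gramSum K N N ∎
      where
      Y N : List X
      Y = filter P? T
      N = filter (¬? ∘ P?) T
      splitRow : ∀ t → ∑ T (K t) ≈ ∑ Y (K t) + ∑ N (K t)
      splitRow t = ∑-partition P? (K t) T
      YN≈0 : gramSum K Y N ≈ 0#
      YN≈0 = gramSum-zero (All.map (λ pt → All.map (vanishesˡ pt) (all-filter (¬? ∘ P?) T))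
                                   (all-filter P? T))
      NY≈0 : gramSum K N Y ≈ 0#
      NY≈0 = gramSum-zero (All.map (λ ¬pt → All.map (vanishesʳ ¬pt) (all-filter P? T))
                                   (all-filter (¬? ∘ P?) T))

module OrderedSums {c ℓ} (R : RealField c ℓ) where
  open RealField R
  open FiniteSums commutativeSemiring

  +-nonneg : ∀ {x y} → 0# ≤ x → 0# ≤ y → 0# ≤ (x + y)
  +-nonneg {x} {y} 0≤x 0≤y =
    ≤-trans 0≤y (≤-trans (≤-refl (sym (+-identityˡ y))) (+-mono-≤ y 0≤x))

  ≤-respʳ-≈ : ∀ {x y z} → x ≤ y → y ≈ z → x ≤ z
  ≤-respʳ-≈ x≤y y≈z = ≤-trans x≤y (≤-refl y≈z)

  gramSum-blockDiagonal-nonneg :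
    ∀ {a i} {X : Set a} {I : Set i} → DecidableEquality I →
    (colour : X → I) (K : X → X → Carrier) →
    (∀ t s → colour t ≢ colour s → K t s ≈ 0#) →
    (∀ {i} T → All (λ t → colour t ≡ i) T → 0# ≤ gramSum K T T) →
    ∀ T → 0# ≤ gramSum K T T
  gramSum-blockDiagonal-nonneg {X = X} _≟ᴵ_ colour K offDiagonal block T =
    go T (<-wellFounded (length T))
    where
    go : ∀ T → Acc _<_ (length T) → 0# ≤ gramSum K T T
    go []      _            = ≤-refl refl
    go (t ∷ T) (acc shorter) =
      ≤-respʳ-≈ (+-nonneg (block sameColour (all-filter sameColour? (t ∷ T)))
                          (go otherColours (shorter otherColours-shorter)))
                (sym (gramSum-partition sameColour?
                       (λ sₜ ¬sₛ → offDiagonal _ _ λ e → ¬sₛ (≡.trans (≡.sym e) sₜ))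
                       (λ ¬sₜ sₛ → offDiagonal _ _ λ e → ¬sₜ (≡.trans e sₛ))
                       (t ∷ T)))
      where
      sameColour? : Decidable (λ s → colour s ≡ colour t)
      sameColour? s = colour s ≟ᴵ colour t
      sameColour otherColours : List X
      sameColour   = filter sameColour? (t ∷ T)
      otherColours = filter (¬? ∘ sameColour?) (t ∷ T)
      otherColours-shorter : length otherColours < length (t ∷ T)
      otherColours-shorter =
        filter-notAll (¬? ∘ sameColour?) (t ∷ T) (here λ t≢t → t≢t ≡.refl)

module GramSumOfStar {c ℓ} (R : RealField c ℓ) (n : ℕ) where
  open RealField R
  open NCPoly R n
  open FiniteSums commutativeSemiring
  private module +CS = CommutativeSemigroupProperties +-commutativeSemigroup
  open import Relation.Binary.Reasoning.Setoid setoid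

  Term : Set c
  Term = Carrier × Word

  pairing : Functional → Term → Term → Carrier
  pairing f (a , u) (b , v) = (a * b) * f (reverse u ++ v)

  pairing-scaleˡ : ∀ f a u s → pairing f (a , u) s ≈ a * pairing f (1# , u) s
  pairing-scaleˡ f a u (b , v) =
    trans (*-assoc a b _) (*-congˡ (*-congʳ (sym (*-identityˡ b))))

  pairing-scaleʳ : ∀ f t b v → pairing f t (b , v) ≈ b * pairing f t (1# , v)
  pairing-scaleʳ f (a , u) b v = begin
    (a * b) * f (reverse u ++ v)         ≈⟨ *-congʳ (*-comm a b) ⟩
    (b * a) * f (reverse u ++ v)         ≈⟨ *-assoc b a _ ⟩
    b * (a * f (reverse u ++ v))         ≈⟨ *-congˡ (*-congʳ (sym (*-identityʳ a))) ⟩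
    b * ((a * 1#) * f (reverse u ++ v))  ∎

  ⟦⟧-++ : ∀ f p q → ⟦ f ⟧ (p ++ q) ≈ ⟦ f ⟧ p + ⟦ f ⟧ q
  ⟦⟧-++ f []      q = sym (+-identityˡ _)
  ⟦⟧-++ f (_ ∷ p) q = trans (+-congˡ (⟦⟧-++ f p q)) (sym (+-assoc _ _ _))

  ⟦⟧-star-· : ∀ f A C → ⟦ f ⟧ (star A · C) ≈ gramSum (pairing f) A C
  ⟦⟧-star-· f []            C = refl
  ⟦⟧-star-· f ((a , u) ∷ A) C =
    trans (⟦⟧-++ f (row C) (star A · C)) (+-cong (⟦⟧-row C) (⟦⟧-star-· f A C))
    where
    row : Poly → Poly
    row = map (λ s → (a * proj₁ s , reverse u ++ proj₂ s))
    ⟦⟧-row : ∀ C → ⟦ f ⟧ (row C) ≈ ∑ C (pairing f (a , u))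
    ⟦⟧-row []      = refl
    ⟦⟧-row (_ ∷ C) = +-congˡ (⟦⟧-row C)

  SplitTerm : Set c
  SplitTerm = Carrier × Word × Fin n

  join : SplitTerm → Term
  join (a , v , i) = a , v ∷ʳ i

  strip : SplitTerm → Term
  strip (a , v , _) = a , v

  lastVar : SplitTerm → Fin n
  lastVar (_ , _ , i) = i

  joinedPairing : Functional → SplitTerm → SplitTerm → Carrier
  joinedPairing f t s = pairing f (join t) (join s)

  nonconstantTerms : Poly → List SplitTerm
  nonconstantTerms []            = []
  nonconstantTerms ((a , w) ∷ A) with initLast w
  ... | []       = nonconstantTerms A
  ... | v ∷ʳ′ i  = (a , v , i) ∷ nonconstantTerms A

  constTerm-∷ʳ : ∀ a v i A → constTerm ((a , v ∷ʳ i) ∷ A) ≡ constTerm A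
  constTerm-∷ʳ a []      i A = ≡.refl
  constTerm-∷ʳ a (_ ∷ _) i A = ≡.refl

  ∑-constant+nonconstant : ∀ {g : Term → Carrier} {k} → (∀ a → g (a , []) ≈ a * k) →
    ∀ A → ∑ A g ≈ constTerm A * k + ∑[ t ∈ nonconstantTerms A ] g (join t)
  ∑-constant+nonconstant {g} {k} g[] [] = sym (trans (+-identityʳ _) (zeroˡ k))
  ∑-constant+nonconstant {g} {k} g[] ((a , w) ∷ A) with initLast w
  ... | [] = begin
    g (a , []) + ∑ A g                ≈⟨ +-cong (g[] a) (∑-constant+nonconstant g[] A) ⟩
    a * k + (constTerm A * k + rest)  ≈⟨ sym (+-assoc _ _ _) ⟩
    (a * k + constTerm A * k) + rest  ≈⟨ +-congʳ (sym (distribʳ k a (constTerm A))) ⟩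
    (a + constTerm A) * k + rest      ∎
    where
    rest : Carrier
    rest = ∑[ t ∈ nonconstantTerms A ] g (join t)
  ... | v ∷ʳ′ i = begin
    g (a , v ∷ʳ i) + ∑ A g
      ≈⟨ +-congˡ (∑-constant+nonconstant g[] A) ⟩
    g (a , v ∷ʳ i) + (constTerm A * k + rest)
      ≈⟨ +CS.x∙yz≈y∙xz _ _ _ ⟩
    constTerm A * k + (g (a , v ∷ʳ i) + rest)
      ≡⟨ ≡.cong (λ c → c * k + (g (a , v ∷ʳ i) + rest)) (≡.sym (constTerm-∷ʳ a v i A)) ⟩
    constTerm ((a , v ∷ʳ i) ∷ A) * k + (g (a , v ∷ʳ i) + rest) ∎
    where
    rest : Carrier
    rest = ∑[ t ∈ nonconstantTerms A ] g (join t)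

  ∑-nonconstant : ∀ {g : Term → Carrier} {k} A → constTerm A ≈ 0# →
                  (∀ a → g (a , []) ≈ a * k) → ∑ A g ≈ ∑[ t ∈ nonconstantTerms A ] g (join t)
  ∑-nonconstant {k = k} A A₀≈0 g[] =
    trans (∑-constant+nonconstant g[] A)
          (trans (+-congʳ (trans (*-congʳ A₀≈0) (zeroˡ k))) (+-identityˡ _))

  gramSum-nonconstant : ∀ f A → constTerm A ≈ 0# →
    let T = nonconstantTerms A in
    gramSum (pairing f) A A ≈ gramSum (joinedPairing f) T T
  gramSum-nonconstant f A A₀≈0 = begin
    ∑[ t ∈ A ] ∑[ s ∈ A ] pairing f t s
      ≈⟨ ∑-cong (All.universal (λ t → ∑-nonconstant A A₀≈0 (constantʳ t)) A) ⟩
    ∑[ t ∈ A ] ∑[ s ∈ T ] pairing f t (join s)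
      ≈⟨ ∑-nonconstant A A₀≈0 constantˡ ⟩
    ∑[ t ∈ T ] ∑[ s ∈ T ] pairing f (join t) (join s) ∎
    where
    T : List SplitTerm
    T = nonconstantTerms A
    constantʳ : ∀ t b → pairing f t (b , []) ≈ b * pairing f t (1# , [])
    constantʳ t b = pairing-scaleʳ f t b []
    constantˡ : ∀ a → ∑[ s ∈ T ] pairing f (a , []) (join s) ≈
                      a * ∑[ s ∈ T ] pairing f (1# , []) (join s)
    constantˡ a = trans (∑-cong (All.universal (λ s → pairing-scaleˡ f a [] (join s)) T))
                        (sym (*-distribˡ-∑ a _ T))

module SandwichFunctional {c ℓ} (R : RealField c ℓ) (n : ℕ) where
  open RealField R
  open NCPoly R n
  open FiniteSums commutativeSemiring
  open OrderedSums R
  open GramSumOfStar R n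
  private module *CS = CommutativeSemigroupProperties *-commutativeSemigroup
  open import Relation.Binary.Reasoning.Setoid setoid

  δ-diagonal : ∀ i → δ i i ≈ 1#
  δ-diagonal i with i ≟ i
  ... | yes _   = refl
  ... | no  i≢i = contradiction ≡.refl i≢i

  δ-offDiagonal : ∀ {i j} → i ≢ j → δ i j ≈ 0#
  δ-offDiagonal {i} {j} i≢j with i ≟ j
  ... | yes i≡j = contradiction i≡j i≢j
  ... | no  _   = refl

  module _ (φ : Fin n → Functional) (ψ : Functional)
           (ψ-sandwich : ∀ i j (P : Poly) →
                         ⟦ ψ ⟧ ((var i · P) · var j) ≈ (δ i j * ⟦ φ i ⟧ P)) where

    ψ-word : ∀ i j w → ψ (i ∷ (w ∷ʳ j)) ≈ δ i j * φ i w
    ψ-word i j w = begin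
      ψ (i ∷ (w ∷ʳ j))
        ≈⟨ sym (trans (+-identityʳ _) (*-identityˡ _)) ⟩
      1# * ψ (i ∷ (w ∷ʳ j)) + 0#
        ≈⟨ +-congʳ (*-congʳ (sym (trans (*-identityʳ _) (*-identityʳ 1#)))) ⟩
      ⟦ ψ ⟧ ((var i · [ (1# , w) ]) · var j)
        ≈⟨ ψ-sandwich i j [ (1# , w) ] ⟩
      δ i j * (1# * φ i w + 0#)
        ≈⟨ *-congˡ (trans (+-identityʳ _) (*-identityˡ _)) ⟩
      δ i j * φ i w ∎

    joinedPairing-sandwich : ∀ t s → joinedPairing ψ t s ≈
      δ (lastVar t) (lastVar s) * pairing (φ (lastVar t)) (strip t) (strip s)
    joinedPairing-sandwich (a , v , i) (b , u , j) = begin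
      (a * b) * ψ (reverse (v ∷ʳ i) ++ (u ∷ʳ j))
        ≡⟨ ≡.cong (λ w → (a * b) * ψ w) (reverse-∷ʳ-++-∷ʳ v i u j) ⟩
      (a * b) * ψ (i ∷ ((reverse v ++ u) ∷ʳ j))
        ≈⟨ *-congˡ (ψ-word i j (reverse v ++ u)) ⟩
      (a * b) * (δ i j * φ i (reverse v ++ u))
        ≈⟨ *CS.x∙yz≈y∙xz (a * b) (δ i j) _ ⟩
      δ i j * ((a * b) * φ i (reverse v ++ u)) ∎

    module _ (φ-pos : ∀ i → PositiveDefinite (φ i)) where

      gramSum-joinedPairing-ψ-nonneg : ∀ T → 0# ≤ gramSum (joinedPairing ψ) T T
      gramSum-joinedPairing-ψ-nonneg =
        gramSum-blockDiagonal-nonneg _≟_ lastVar (joinedPairing ψ) offDiagonal block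
        where
        offDiagonal : ∀ t s → lastVar t ≢ lastVar s → joinedPairing ψ t s ≈ 0#
        offDiagonal t s t≢s =
          trans (joinedPairing-sandwich t s) (trans (*-congʳ (δ-offDiagonal t≢s)) (zeroˡ _))
        onBlock : ∀ {i} t s → lastVar t ≡ i → lastVar s ≡ i →
                  joinedPairing ψ t s ≈ pairing (φ i) (strip t) (strip s)
        onBlock t@(_ , _ , i) s@(_ , _ , .i) ≡.refl ≡.refl =
          trans (joinedPairing-sandwich t s) (trans (*-congʳ (δ-diagonal i)) (*-identityˡ _))
        block : ∀ {i} T → All (λ t → lastVar t ≡ i) T → 0# ≤ gramSum (joinedPairing ψ) T T
        block {i} T inBlock = ≤-respʳ-≈ (φ-pos i B) (begin
          ⟦ φ i ⟧ (star B · B)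
            ≈⟨ ⟦⟧-star-· (φ i) B B ⟩
          gramSum (pairing (φ i)) B B
            ≈⟨ gramSum-map strip (pairing (φ i)) T ⟩
          gramSum (λ t s → pairing (φ i) (strip t) (strip s)) T T
            ≈⟨ gramSum-cong (All.map (λ {t} tᵢ → All.map (λ {s} sᵢ → sym (onBlock t s tᵢ sᵢ))
                                                         inBlock)
                                     inBlock) ⟩
          gramSum (joinedPairing ψ) T T ∎)
          where
          B : Poly
          B = map strip T

      ψ-conditionallyPositiveDefinite : ConditionallyPositiveDefinite ψ
      ψ-conditionallyPositiveDefinite A A₀≈0 =
        ≤-respʳ-≈ (gramSum-joinedPairing-ψ-nonneg T) (sym (begin
          ⟦ ψ ⟧ (star A · A)            ≈⟨ ⟦⟧-star-· ψ A A ⟩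
          gramSum (pairing ψ) A A       ≈⟨ gramSum-nonconstant ψ A A₀≈0 ⟩
          gramSum (joinedPairing ψ) T T ∎))
        where
        T : List SplitTerm
        T = nonconstantTerms A

-- Only the sandwich rule for ψ is used: A* A has no words of length < 2 when A has no
-- constant term, and ψ[xᵢ xⱼ] = δᵢⱼ is the case P = 1 of that rule for unital φᵢ.
lemma5p5 : ∀ {c ℓ} (R : RealField c ℓ) (n : ℕ) →
    let open RealField R
        open NCPoly R n
    in (φ : Fin n → Functional) →
       (∀ i → Unital (φ i)) →
       (∀ i → PositiveDefinite (φ i)) →
       (ψ : Functional) →
       ⟦ ψ ⟧ one ≈ 0# →
       (∀ i → ⟦ ψ ⟧ (var i) ≈ 0#) →
       (∀ i j → ⟦ ψ ⟧ (var i · var j) ≈ δ i j) →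
       (∀ i j (P : Poly) → ⟦ ψ ⟧ ((var i · P) · var j) ≈ (δ i j * ⟦ φ i ⟧ P)) →
       ConditionallyPositiveDefinite ψ
lemma5p5 R n φ _ φ-pos ψ _ _ _ ψ-sandwich =
  SandwichFunctional.ψ-conditionallyPositiveDefinite R n φ ψ ψ-sandwich φ-pos
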